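{- Let $T,T',S$ be finite sets and let $n<\omega$. If $\exists$ has a winning strategy in the Seurat game for sets $\mathbf G_n(T,T')$, then $\exists$ has a winning strategy in the equivalence game $\Gamma_n(\mathcal B_{T,S},\mathcal B_{T',S})$ (starting from the empty position).
   Context: For sets $X,Y$, $\mathcal B_{X,Y}$ is the complex algebra of the following relation algebra atom structure. Atoms: $\{1',\mathsf b,\mathsf w,\mathsf y\}\cup\{\mathsf g_i:i\in X\}\cup\{\mathsf r_{j,j'}:j,j'\in Y\}$ ($1'$ the identity atom; $\mathsf g_i$ are called green, $\mathsf r_{j,j'}$ red). All atoms are self-converse except $(\mathsf r_{j,j'})^\smile=\mathsf r_{j',j}$. A triple of atoms $(a,b,c)$ is forbidden (meaning $(a;b)\cdot c=0$) iff it is one of the Peircean transforms $(a,b,c),(a^\smile,c,b),(c,b^\smile,a),(b,c^\smile,a^\smile),(c^\smile,a,b^\smile),(b^\smile,a^\smile,c^\smile)$ of one of: (I) $(1',a,b)$ with $a\ne b$; (II) $(\mathsf g_i,\mathsf g_{i'},\mathsf g_{i''})$, $(\mathsf g_i,\mathsf g_{i'},\mathsf w)$; (III) $(\mathsf y,\mathsf y,\mathsf y)$, $(\mathsf y,\mathsf y,\mathsf b)$; (IV) $(\mathsf r_{j_1,j_2},\mathsf r_{j_2',j_3'},\mathsf r_{j_1^*,j_3^*})$ unless $j_1=j_1^*$, $j_2=j_2'$, $j_3'=j_3^*$; (V) $(\mathsf g_i,\mathsf g_i,\mathsf r_{j,j'})$, $(\mathsf g_i,\mathsf g_{i'},\mathsf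 r_{j,j})$. The complex algebra has all sets of atoms as elements, set Boolean operations, identity $\{1'\}$, pointwise converse, and $X;Y=\{c:\exists a\in X,b\in Y,\ (a,b,c)\text{ not forbidden}\}$. The Seurat game $\mathbf G_n(T,T')$: in each of $n$ rounds $i$, $\forall$ picks a subset of $T$ or of $T'$ and $\exists$ picks a subset of the other, producing pairs $(T_i,T'_i)$. For a palette $\pi\subseteq\{i:i<n\}$ and position $p$ (after $m$ rounds), $\pi^p_T=\{x\in T:\forall j<m\,(x\in T_j\iff j\in\pi)\}$, similarly $\pi^p_{T'}$ (both equal to the whole set when $m=0$). $\forall$ wins if at some position there is a palette $\pi$ with $|\pi^p_T|\ne|\pi^p_{T'}|$ and ($|\pi^p_T|<2$ or $|\pi^p_{T'}|<2$); otherwise $\exists$ wins. The game $\Gamma_n(\mathcal A,\mathcal B)$: in each of $n$ rounds $\forall$ picks an element of one of the relation algebras $\mathcal A,\mathcal B$ and $\exists$ an element of the other, giving pairs $(a_i,b_i)$. $\exists$ wins iff at the end the map sending the value of each relation algebra term $t(a_0,\dots,a_{n-1})$ to the value of $t(b_0,\dots,b_{n-1})$ is a well-defined isomorphism between the subalgebras generated by $\bar a$ and $\bar b$. -}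

module Defs where

open import Data.Nat using (ℕ; zero; suc; _<_)
open import Data.Fin using (Fin) renaming (_≟_ to _≟ᶠ_)
open import Data.Fin.Subset using (Subset; ∣_∣)
open import Data.Bool using (Bool; true; false; _∧_; _∨_; not)
open import Data.Vec using (Vec; []; _∷_; _∷ʳ_; lookup; tabulate; map)
open import Data.List using (List; []; _∷_; _++_; concatMap)
open import Data.Bool.ListAction using (any)
import Data.List as L
open import Data.Fin using (zero; suc)
open import Data.Product using (_×_; _,_; Σ; proj₁; proj₂)
open import Data.Sum using (_⊎_)
open import Relation.Nullary using (¬_)
open import Relation.Nullary.Decidable using (⌊_⌋)
open import Relation.Binary.PropositionalEquality using (_≡_; _≢_)
open import Function.Bundles using (_⇔_)

_=ᶠ_ : {k : ℕ} → Fin k → Fin k → Bool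
i =ᶠ j = ⌊ i ≟ᶠ j ⌋

_=ᵇ_ : Bool → Bool → Bool
true =ᵇ true = true
false =ᵇ false = true
_ =ᵇ _ = false

-- The atom structure of B_{X,Y} with X = Fin x, Y = Fin y.

data Atom (x y : ℕ) : Set where
  one : Atom x y
  b   : Atom x y
  w   : Atom x y
  yy  : Atom x y
  g   : Fin x → Atom x y
  r   : Fin y → Fin y → Atom x y

_==_ : {x y : ℕ} → Atom x y → Atom x y → Bool
one == one = true
b == b = true
w == w = true
yy == yy = true
g i == g i' = i =ᶠ i'
r j k == r j' k' = (j =ᶠ j') ∧ (k =ᶠ k')
_ == _ = false

conv : {x y : ℕ} → Atom x y → Atom x y
conv (r j k) = r k j
conv a = a

basic : {x y : ℕ} → Atom x y → Atom x y → Atom x y → Bool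
basic one a c = not (a == c)
basic (g _) (g _) (g _) = true
basic (g _) (g _) w = true
basic yy yy yy = true
basic yy yy b = true
basic (r j₁ j₂) (r j₂' j₃') (r k₁ k₃) = not ((j₁ =ᶠ k₁) ∧ ((j₂ =ᶠ j₂') ∧ (j₃' =ᶠ k₃)))
basic (g i) (g i') (r j j') = (i =ᶠ i') ∨ (j =ᶠ j')
basic _ _ _ = false

-- (a,b,c) is forbidden iff it is a Peircean transform of a basic forbidden triple,
-- i.e. iff one of its Peircean transforms is basic forbidden (the transforms form a group).
forbidden : {x y : ℕ} → Atom x y → Atom x y → Atom x y → Bool
forbidden a a' c =
  basic a a' c ∨ (basic (conv a) c a' ∨ (basic c (conv a') a ∨
  (basic a' (conv c) (conv a) ∨ (basic (conv c) a (conv a') ∨ basic (conv a') (conv a) (conv c)))))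

allAtoms : (x y : ℕ) → List (Atom x y)
allAtoms x y = one ∷ b ∷ w ∷ yy ∷
  (L.map g (L.allFin x) ++ concatMap (λ j → L.map (r j) (L.allFin y)) (L.allFin y))

-- The complex algebra B_{X,Y}: elements are all sets of atoms.

Elt : ℕ → ℕ → Set
Elt x y = Atom x y → Bool

module _ {x y : ℕ} where
  _∪ᴮ_ : Elt x y → Elt x y → Elt x y
  (P ∪ᴮ Q) a = P a ∨ Q a

  _∩ᴮ_ : Elt x y → Elt x y → Elt x y
  (P ∩ᴮ Q) a = P a ∧ Q a

  compᴮ : Elt x y → Elt x y
  compᴮ P a = not (P a)

  zeroᴮ : Elt x y
  zeroᴮ _ = false

  topᴮ : Elt x y
  topᴮ _ = true

  idᴮ : Elt x y
  idᴮ a = a == one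

  convᴮ : Elt x y → Elt x y
  convᴮ P a = P (conv a)

  _⨾ᴮ_ : Elt x y → Elt x y → Elt x y
  (P ⨾ᴮ Q) c = any (λ a → any (λ a' → P a ∧ (Q a' ∧ not (forbidden a a' c))) (allAtoms x y)) (allAtoms x y)

  _≈ᴮ_ : Elt x y → Elt x y → Set
  P ≈ᴮ Q = ∀ a → P a ≡ Q a

data Term (m : ℕ) : Set where
  var  : Fin m → Term m
  0t 1t 1't : Term m
  _+t_ _·t_ _⨾t_ : Term m → Term m → Term m
  -t_ ˘t_ : Term m → Term m

evalᴮ : {x y m : ℕ} → Vec (Elt x y) m → Term m → Elt x y
evalᴮ ρ (var i) = lookup ρ i
evalᴮ ρ 0t = zeroᴮ
evalᴮ ρ 1t = topᴮ
evalᴮ ρ 1't = idᴮ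
evalᴮ ρ (t +t u) = evalᴮ ρ t ∪ᴮ evalᴮ ρ u
evalᴮ ρ (t ·t u) = evalᴮ ρ t ∩ᴮ evalᴮ ρ u
evalᴮ ρ (t ⨾t u) = evalᴮ ρ t ⨾ᴮ evalᴮ ρ u
evalᴮ ρ (-t t) = compᴮ (evalᴮ ρ t)
evalᴮ ρ (˘t t) = convᴮ (evalᴮ ρ t)

-- t(ā) ↦ t(b̄) is a well-defined isomorphism between the generated subalgebras
-- (it is then automatically a surjective homomorphism; well-definedness plus
-- injectivity is exactly the following).
IsoCond : {x x' y m : ℕ} → Vec (Elt x y) m → Vec (Elt x' y) m → Set
IsoCond ās b̄s = ∀ t u → (evalᴮ ās t ≈ᴮ evalᴮ ās u) ⇔ (evalᴮ b̄s t ≈ᴮ evalᴮ b̄s u)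

-- ∃ has a winning strategy in the remaining k rounds of Γ(B_{x,s}, B_{x',s})
-- from the position (ā, b̄) (pairs (a_i,b_i) listed in order of play).
ΓWin : {x x' s m : ℕ} → ℕ → Vec (Elt x s) m → Vec (Elt x' s) m → Set
ΓWin zero ās b̄s = IsoCond ās b̄s
ΓWin {x} {x'} {s} (suc k) ās b̄s =
  (∀ (a : Elt x s) → Σ (Elt x' s) λ c → ΓWin k (ās ∷ʳ a) (b̄s ∷ʳ c)) ×
  (∀ (c : Elt x' s) → Σ (Elt x s) λ a → ΓWin k (ās ∷ʳ a) (b̄s ∷ʳ c))

EGameWin : (n x x' s : ℕ) → Set
EGameWin n x x' s = ΓWin {x} {x'} {s} n [] []

-- Seurat game G_n(T,T') with T = Fin x, T' = Fin x'.

-- membership of z in π^p given the chosen subsets T_0..T_{m-1} and the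
-- palette π restricted to {0..m-1}
inPal : {x m : ℕ} → Vec (Subset x) m → Vec Bool m → Fin x → Bool
inPal [] [] z = true
inPal (Tj ∷ Ts) (πj ∷ π) z = (lookup Tj z =ᵇ πj) ∧ inPal Ts π z

palCount : {x m : ℕ} → Vec (Subset x) m → Vec Bool m → ℕ
palCount {x} Ts π = ∣ tabulate {n = x} (inPal Ts π) ∣

∀WinsAt : ℕ → ℕ → Set
∀WinsAt c c' = c ≢ c' × (c < 2 ⊎ c' < 2)

SeuratOk : {x x' m : ℕ} → Vec (Subset x × Subset x') m → Set
SeuratOk {m = m} p =
  (π : Vec Bool m) → ¬ ∀WinsAt (palCount (map proj₁ p) π) (palCount (map proj₂ p) π)

SWin : {x x' m : ℕ} → ℕ → Vec (Subset x × Subset x') m → Set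
SWin zero p = SeuratOk p
SWin {x} {x'} (suc k) p = SeuratOk p ×
  ((∀ (A : Subset x) → Σ (Subset x') λ A' → SWin k (p ∷ʳ (A , A'))) ×
   (∀ (A' : Subset x') → Σ (Subset x) λ A → SWin k (p ∷ʳ (A , A'))))

SeuratWin : (n x x' : ℕ) → Set
SeuratWin n x x' = SWin {x} {x'} n []

-- ∃ copies every element on the non-green atoms and plays its green part, read as a subset of T
-- or of T', by a winning strategy of the Seurat game. Call g_i and g_i' corresponding when i and i'
-- lie in the same palette. The Seurat condition (equal counts, or both counts at least 2) makes this
-- correspondence total in both directions, and lets one green correspondence be extended by a new
-- point while preserving equality of indices. By induction on terms, every term then takes the same
-- value on corresponding atoms. The only delicate case is composition: since green triangles are
-- forbidden, an allowed triangle has at most two green vertices, so a single extension step carries it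
-- to an allowed triangle on the other side. Totality turns agreement on atoms into the isomorphism
-- condition.

module Submission where

open import Defs
open import Data.Bool using (Bool; true; false; _∧_; _∨_; not)
open import Data.Bool.ListAction using (any)
open import Data.Bool.Properties using (T-≡; T-∧; T-not-≡; ⇔→≡; ∧-conicalˡ; ∧-conicalʳ)
open import Data.Empty using (⊥)
open import Data.Fin using (Fin; zero; suc; _≟_)
open import Data.Fin.Properties using (any?)
open import Data.Fin.Subset using (Subset; ∣_∣; _∈_; _⊆_; ⁅_⁆; Nonempty)
open import Data.Fin.Subset.Properties
  using (_∈?_; nonempty?; Empty-unique; ∣⊥∣≡0; ∣⁅x⁆∣≡1; x∈⁅x⁆; x∈⁅y⁆⇒x≡y;
         p⊆q⇒∣p∣≤∣q∣; x∈p⇒∣p-x∣<∣p∣; x∈p∧x≢y⇒x∈p-y)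
open import Data.List.Membership.Propositional using (lose) renaming (_∈_ to _∈ᴸ_)
open import Data.List.Membership.Propositional.Properties using (∈-map⁺; ∈-++⁺ˡ; ∈-++⁺ʳ; ∈-concatMap⁺; ∈-allFin)
open import Data.List.Relation.Unary.Any using (here; there; satisfied)
import Data.List.Relation.Unary.Any as Any
open import Data.List.Relation.Unary.Any.Properties using (any⁺; any⁻)
import Data.List as List
open import Data.Nat using (ℕ; zero; suc; _≤_; _≤?_; s≤s; z≤n)
open import Data.Nat.Properties using (≤-refl; ≤-trans; <-≤-trans; ≰⇒>)
open import Data.Product using (_×_; _,_; Σ-syntax; ∃; proj₁; proj₂)
open import Data.Sum using (inj₂)
import Data.Sum as Sum
open import Data.Unit using (⊤; tt)
open import Data.Vec using (Vec; []; _∷_; _∷ʳ_; lookup; tabulate; map)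
open import Data.Vec.Properties using (lookup-map; lookup∘tabulate; []=⇒lookup; lookup⇒[]=)
open import Function using (_∘_; flip)
open import Function.Bundles using (_⇔_; mk⇔; Equivalence)
open import Relation.Binary.PropositionalEquality
open import Relation.Nullary using (¬_; Dec; yes; no; contradiction)
open import Relation.Nullary.Decidable using (⌊_⌋; decidable-stable; _×-dec_; ¬?)

open Equivalence using (to; from)

variable
  m n t t' s : ℕ

=ᶠ-refl : (i : Fin n) → (i =ᶠ i) ≡ true
=ᶠ-refl i = cong ⌊_⌋ (≡-≟-identity _≟_ {i} refl)

≢⇒=ᶠ-false : {i k : Fin n} → i ≢ k → (i =ᶠ k) ≡ false
≢⇒=ᶠ-false i≢k = cong ⌊_⌋ (≢-≟-identity _≟_ i≢k)

=ᶠ-sym : (i k : Fin n) → (i =ᶠ k) ≡ (k =ᶠ i)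
=ᶠ-sym i k with i ≟ k
... | yes refl = sym (=ᶠ-refl i)
... | no i≢k = sym (≢⇒=ᶠ-false (i≢k ∘ sym))

data AtomRel {t t' s : ℕ} (C : Fin t → Fin t' → Set) : Atom t s → Atom t' s → Set where
  one~ : AtomRel C one one
  b~   : AtomRel C b b
  w~   : AtomRel C w w
  yy~  : AtomRel C yy yy
  g~   : ∀ {i i'} → C i i' → AtomRel C (g i) (g i')
  r~   : ∀ {j k} → AtomRel C (r j k) (r j k)

data IsGreen {t s : ℕ} : Atom t s → Set where
  green : ∀ i → IsGreen (g i)

isGreen? : (a : Atom t s) → Dec (IsGreen a)
isGreen? one = no λ ()
isGreen? b = no λ ()
isGreen? w = no λ ()
isGreen? yy = no λ ()
isGreen? (g i) = yes (green i)
isGreen? (r j k) = no λ ()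

module _ {C : Fin t → Fin t' → Set} where

  conv~ : {a : Atom t s} {b : Atom t' s} → AtomRel C a b → AtomRel C (conv a) (conv b)
  conv~ one~ = one~
  conv~ b~ = b~
  conv~ w~ = w~
  conv~ yy~ = yy~
  conv~ (g~ c) = g~ c
  conv~ r~ = r~

  flip~ : {a : Atom t s} {b : Atom t' s} → AtomRel C a b → AtomRel (flip C) b a
  flip~ one~ = one~
  flip~ b~ = b~
  flip~ w~ = w~
  flip~ yy~ = yy~
  flip~ (g~ c) = g~ c
  flip~ r~ = r~

  -- Only this much of the green indices is visible to _==_ and to basic.
  Coherent : {a c : Atom t s} {b d : Atom t' s} → AtomRel C a b → AtomRel C c d → Set
  Coherent (g~ {i} {i'} _) (g~ {k} {k'} _) = (i =ᶠ k) ≡ (i' =ᶠ k')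
  Coherent _ _ = ⊤

  coherent-sym : {a c : Atom t s} {b d : Atom t' s} (ra : AtomRel C a b) (rc : AtomRel C c d) →
                 Coherent ra rc → Coherent rc ra
  coherent-sym (g~ {i} {i'} _) (g~ {k} {k'} _) coh = trans (=ᶠ-sym k i) (trans coh (=ᶠ-sym i' k'))
  coherent-sym _ one~ _ = tt
  coherent-sym _ b~ _ = tt
  coherent-sym _ w~ _ = tt
  coherent-sym _ yy~ _ = tt
  coherent-sym _ r~ _ = tt
  coherent-sym one~ (g~ _) _ = tt
  coherent-sym b~ (g~ _) _ = tt
  coherent-sym w~ (g~ _) _ = tt
  coherent-sym yy~ (g~ _) _ = tt
  coherent-sym r~ (g~ _) _ = tt

  coherent-convˡ : {a c : Atom t s} {b d : Atom t' s} (ra : AtomRel C a b) (rc : AtomRel C c d) →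
                   Coherent ra rc → Coherent (conv~ ra) rc
  coherent-convˡ one~ _ coh = coh
  coherent-convˡ b~ _ coh = coh
  coherent-convˡ w~ _ coh = coh
  coherent-convˡ yy~ _ coh = coh
  coherent-convˡ (g~ _) _ coh = coh
  coherent-convˡ r~ _ coh = coh

  coherent-convʳ : {a c : Atom t s} {b d : Atom t' s} (ra : AtomRel C a b) (rc : AtomRel C c d) →
                   Coherent ra rc → Coherent ra (conv~ rc)
  coherent-convʳ ra rc = coherent-sym (conv~ rc) ra ∘ coherent-convˡ rc ra ∘ coherent-sym ra rc

  coherent-conv : {a c : Atom t s} {b d : Atom t' s} (ra : AtomRel C a b) (rc : AtomRel C c d) →
                  Coherent ra rc → Coherent (conv~ ra) (conv~ rc)
  coherent-conv ra rc = coherent-convˡ ra (conv~ rc) ∘ coherent-convʳ ra rc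

  ==-resp : {a c : Atom t s} {b d : Atom t' s} (ra : AtomRel C a b) (rc : AtomRel C c d) →
            Coherent ra rc → (a == c) ≡ (b == d)
  ==-resp one~ one~ _ = refl
  ==-resp one~ b~ _ = refl
  ==-resp one~ w~ _ = refl
  ==-resp one~ yy~ _ = refl
  ==-resp one~ (g~ _) _ = refl
  ==-resp one~ r~ _ = refl
  ==-resp b~ one~ _ = refl
  ==-resp b~ b~ _ = refl
  ==-resp b~ w~ _ = refl
  ==-resp b~ yy~ _ = refl
  ==-resp b~ (g~ _) _ = refl
  ==-resp b~ r~ _ = refl
  ==-resp w~ one~ _ = refl
  ==-resp w~ b~ _ = refl
  ==-resp w~ w~ _ = refl
  ==-resp w~ yy~ _ = refl
  ==-resp w~ (g~ _) _ = refl
  ==-resp w~ r~ _ = refl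
  ==-resp yy~ one~ _ = refl
  ==-resp yy~ b~ _ = refl
  ==-resp yy~ w~ _ = refl
  ==-resp yy~ yy~ _ = refl
  ==-resp yy~ (g~ _) _ = refl
  ==-resp yy~ r~ _ = refl
  ==-resp (g~ _) one~ _ = refl
  ==-resp (g~ _) b~ _ = refl
  ==-resp (g~ _) w~ _ = refl
  ==-resp (g~ _) yy~ _ = refl
  ==-resp (g~ _) (g~ _) coh = coh
  ==-resp (g~ _) r~ _ = refl
  ==-resp r~ one~ _ = refl
  ==-resp r~ b~ _ = refl
  ==-resp r~ w~ _ = refl
  ==-resp r~ yy~ _ = refl
  ==-resp r~ (g~ _) _ = refl
  ==-resp r~ r~ _ = refl

  coherent-nonGreenˡ : {a c : Atom t s} {b d : Atom t' s} (ra : AtomRel C a b) (rc : AtomRel C c d) →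
                       ¬ IsGreen a → Coherent ra rc
  coherent-nonGreenˡ one~ _ _ = tt
  coherent-nonGreenˡ b~ _ _ = tt
  coherent-nonGreenˡ w~ _ _ = tt
  coherent-nonGreenˡ yy~ _ _ = tt
  coherent-nonGreenˡ (g~ _) _ ¬green = contradiction (green _) ¬green
  coherent-nonGreenˡ r~ _ _ = tt

  coherent-nonGreenʳ : {a c : Atom t s} {b d : Atom t' s} (ra : AtomRel C a b) (rc : AtomRel C c d) →
                       ¬ IsGreen c → Coherent ra rc
  coherent-nonGreenʳ ra rc ¬green = coherent-sym rc ra (coherent-nonGreenˡ rc ra ¬green)

  basic-resp : {a₁ a₂ a₃ : Atom t s} {b₁ b₂ b₃ : Atom t' s}
               (r₁ : AtomRel C a₁ b₁) (r₂ : AtomRel C a₂ b₂) (r₃ : AtomRel C a₃ b₃) →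
               Coherent r₁ r₂ → Coherent r₂ r₃ → basic a₁ a₂ a₃ ≡ basic b₁ b₂ b₃
  basic-resp one~ r₂ r₃ _ coh₂₃ = cong not (==-resp r₂ r₃ coh₂₃)
  basic-resp b~ _ _ _ _ = refl
  basic-resp w~ _ _ _ _ = refl
  basic-resp yy~ one~ _ _ _ = refl
  basic-resp yy~ b~ _ _ _ = refl
  basic-resp yy~ w~ _ _ _ = refl
  basic-resp yy~ (g~ _) _ _ _ = refl
  basic-resp yy~ r~ _ _ _ = refl
  basic-resp yy~ yy~ one~ _ _ = refl
  basic-resp yy~ yy~ b~ _ _ = refl
  basic-resp yy~ yy~ w~ _ _ = refl
  basic-resp yy~ yy~ yy~ _ _ = refl
  basic-resp yy~ yy~ (g~ _) _ _ = refl
  basic-resp yy~ yy~ r~ _ _ = refl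
  basic-resp (g~ _) one~ _ _ _ = refl
  basic-resp (g~ _) b~ _ _ _ = refl
  basic-resp (g~ _) w~ _ _ _ = refl
  basic-resp (g~ _) yy~ _ _ _ = refl
  basic-resp (g~ _) r~ _ _ _ = refl
  basic-resp (g~ _) (g~ _) one~ _ _ = refl
  basic-resp (g~ _) (g~ _) b~ _ _ = refl
  basic-resp (g~ _) (g~ _) w~ _ _ = refl
  basic-resp (g~ _) (g~ _) yy~ _ _ = refl
  basic-resp (g~ _) (g~ _) (g~ _) _ _ = refl
  basic-resp (g~ _) (g~ _) r~ coh₁₂ _ = cong (_∨ _) coh₁₂
  basic-resp r~ one~ _ _ _ = refl
  basic-resp r~ b~ _ _ _ = refl
  basic-resp r~ w~ _ _ _ = refl
  basic-resp r~ yy~ _ _ _ = refl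
  basic-resp r~ (g~ _) _ _ _ = refl
  basic-resp r~ r~ one~ _ _ = refl
  basic-resp r~ r~ b~ _ _ = refl
  basic-resp r~ r~ w~ _ _ = refl
  basic-resp r~ r~ yy~ _ _ = refl
  basic-resp r~ r~ (g~ _) _ _ = refl
  basic-resp r~ r~ r~ _ _ = refl

  record CoherentTriple {a₁ a₂ a₃ : Atom t s} {b₁ b₂ b₃ : Atom t' s}
           (r₁ : AtomRel C a₁ b₁) (r₂ : AtomRel C a₂ b₂) (r₃ : AtomRel C a₃ b₃) : Set where
    constructor coherent
    field
      coh₁₂ : Coherent r₁ r₂
      coh₁₃ : Coherent r₁ r₃
      coh₂₃ : Coherent r₂ r₃

  forbidden-resp : {a₁ a₂ a₃ : Atom t s} {b₁ b₂ b₃ : Atom t' s}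
                   (r₁ : AtomRel C a₁ b₁) (r₂ : AtomRel C a₂ b₂) (r₃ : AtomRel C a₃ b₃) →
                   CoherentTriple r₁ r₂ r₃ → forbidden a₁ a₂ a₃ ≡ forbidden b₁ b₂ b₃
  forbidden-resp r₁ r₂ r₃ (coherent c₁₂ c₁₃ c₂₃) =
    cong₂ _∨_ (basic-resp r₁ r₂ r₃ c₁₂ c₂₃)
    (cong₂ _∨_ (basic-resp (conv~ r₁) r₃ r₂ (coherent-convˡ r₁ r₃ c₁₃) c₃₂)
    (cong₂ _∨_ (basic-resp r₃ (conv~ r₂) r₁ (coherent-convʳ r₃ r₂ c₃₂) (coherent-convˡ r₂ r₁ c₂₁))
    (cong₂ _∨_ (basic-resp r₂ (conv~ r₃) (conv~ r₁) (coherent-convʳ r₂ r₃ c₂₃) (coherent-conv r₃ r₁ c₃₁))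
    (cong₂ _∨_ (basic-resp (conv~ r₃) r₁ (conv~ r₂) (coherent-convˡ r₃ r₁ c₃₁) (coherent-convʳ r₁ r₂ c₁₂))
               (basic-resp (conv~ r₂) (conv~ r₁) (conv~ r₃) (coherent-conv r₂ r₁ c₂₁) (coherent-conv r₁ r₃ c₁₃))))))
    where
    c₂₁ : Coherent r₂ r₁
    c₂₁ = coherent-sym r₁ r₂ c₁₂
    c₃₁ : Coherent r₃ r₁
    c₃₁ = coherent-sym r₁ r₃ c₁₃
    c₃₂ : Coherent r₃ r₂
    c₃₂ = coherent-sym r₂ r₃ c₂₃

record Forth (C : Fin t → Fin t' → Set) : Set where
  field
    total  : ∀ i → ∃ (C i)
    extend : ∀ {k k'} → C k k' → ∀ i → ∃ λ i' → C i i' × (i =ᶠ k) ≡ (i' =ᶠ k')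

Forth-resp : {C D : Fin t → Fin t' → Set} → (∀ {i i'} → C i i' ⇔ D i i') → Forth C → Forth D
Forth-resp C⇔D F = record
  { total  = λ i → let i' , c = total i in i' , to C⇔D c
  ; extend = λ d i → let i' , c , same = extend (from C⇔D d) i in i' , to C⇔D c , same
  }
  where open Forth F

record BackAndForth (C : Fin t → Fin t' → Set) : Set where
  field
    forth : Forth C
    back  : Forth (flip C)

module _ {C : Fin t → Fin t' → Set} (F : Forth C) where

  open Forth F

  coherentPartner : (a : Atom t s) {z : Atom t s} {z' : Atom t' s} (rz : AtomRel C z z') →
                    Σ[ a' ∈ Atom t' s ] Σ[ ra ∈ AtomRel C a a' ] Coherent ra rz
  coherentPartner one _ = one , one~ , tt
  coherentPartner b _ = b , b~ , tt
  coherentPartner w _ = w , w~ , tt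
  coherentPartner yy _ = yy , yy~ , tt
  coherentPartner (r j k) _ = r j k , r~ , tt
  coherentPartner (g i) (g~ c) = let i' , c' , same = extend c i in g i' , g~ c' , same
  coherentPartner (g i) one~ = g (proj₁ (total i)) , g~ (proj₂ (total i)) , tt
  coherentPartner (g i) b~ = g (proj₁ (total i)) , g~ (proj₂ (total i)) , tt
  coherentPartner (g i) w~ = g (proj₁ (total i)) , g~ (proj₂ (total i)) , tt
  coherentPartner (g i) yy~ = g (proj₁ (total i)) , g~ (proj₂ (total i)) , tt
  coherentPartner (g i) r~ = g (proj₁ (total i)) , g~ (proj₂ (total i)) , tt

  record MatchedTriangle (a a' : Atom t s) {x : Atom t s} {y : Atom t' s} (rx : AtomRel C x y) : Set where
    constructor matched
    field
      {b₁ b₂} : Atom t' s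
      ra  : AtomRel C a b₁
      ra' : AtomRel C a' b₂
      coh : CoherentTriple ra ra' rx

  matchTriangle : (a a' : Atom t s) {x : Atom t s} {y : Atom t' s} (rx : AtomRel C x y) →
                  forbidden a a' x ≡ false → MatchedTriangle a a' rx
  matchTriangle a a' {x} rx allowed with isGreen? a | isGreen? a' | isGreen? x
  ... | no ¬ga | _ | _ =
    let _ , ra , c₁₃ = coherentPartner a rx ; _ , ra' , c₂₃ = coherentPartner a' rx
    in matched ra ra' (coherent (coherent-nonGreenˡ ra ra' ¬ga) c₁₃ c₂₃)
  ... | yes _ | no ¬ga' | _ =
    let _ , ra , c₁₃ = coherentPartner a rx ; _ , ra' , c₂₃ = coherentPartner a' rx
    in matched ra ra' (coherent (coherent-nonGreenʳ ra ra' ¬ga') c₁₃ c₂₃)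
  ... | yes _ | yes _ | no ¬gx =
    let _ , ra , c₁₃ = coherentPartner a rx ; _ , ra' , c₂₁ = coherentPartner a' ra
    in matched ra ra' (coherent (coherent-sym ra' ra c₂₁) c₁₃ (coherent-nonGreenʳ ra' rx ¬gx))
  ... | yes (green _) | yes (green _) | yes (green _) = contradiction allowed λ ()  -- green triangles are forbidden

∈-allAtoms : (a : Atom t s) → a ∈ᴸ allAtoms t s
∈-allAtoms one = here refl
∈-allAtoms b = there (here refl)
∈-allAtoms w = there (there (here refl))
∈-allAtoms yy = there (there (there (here refl)))
∈-allAtoms (g i) = there (there (there (there (∈-++⁺ˡ (∈-map⁺ g (∈-allFin i))))))
∈-allAtoms {t} {s} (r j k) = there (there (there (there (∈-++⁺ʳ (List.map g (List.allFin t))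
  (∈-concatMap⁺ (λ j → List.map (r j) (List.allFin s))
    (Any.map (λ { refl → ∈-map⁺ (r j) (∈-allFin k) }) (∈-allFin j)))))))

record CompositionWitness (P Q : Elt t s) (c : Atom t s) : Set where
  constructor witness
  field
    {a a'}  : Atom t s
    P∋a     : P a ≡ true
    Q∋a'    : Q a' ≡ true
    allowed : forbidden a a' c ≡ false

module _ {P Q : Elt t s} {c : Atom t s} where

  private
    compatible : Atom t s → Atom t s → Bool
    compatible a a' = P a ∧ (Q a' ∧ not (forbidden a a' c))

  ⨾ᴮ-intro : CompositionWitness P Q c → (P ⨾ᴮ Q) c ≡ true
  ⨾ᴮ-intro (witness {a} {a'} P∋a Q∋a' allowed) =
    to T-≡ (any⁺ (λ a → any (compatible a) (allAtoms t s)) (lose (∈-allAtoms a)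
      (any⁺ (compatible a) (lose (∈-allAtoms a')
        (from T-≡ (cong₂ _∧_ P∋a (cong₂ _∧_ Q∋a' (cong not allowed))))))))

  ⨾ᴮ-elim : (P ⨾ᴮ Q) c ≡ true → CompositionWitness P Q c
  ⨾ᴮ-elim h =
    let a , h₁ = satisfied (any⁻ (λ a → any (compatible a) (allAtoms t s)) (allAtoms t s)
                                  (from T-≡ h))
        a' , h₂ = satisfied (any⁻ (compatible a) (allAtoms t s) h₁)
        P∋a , h₃ = to (T-∧ {P a}) h₂
        Q∋a' , allowed = to (T-∧ {Q a'}) h₃
    in witness (to T-≡ P∋a) (to T-≡ Q∋a') (to T-not-≡ allowed)

Respects : (Fin t → Fin t' → Set) → Elt t s → Elt t' s → Set
Respects C P P' = ∀ {a b} → AtomRel C a b → P a ≡ P' b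

Respects-flip : {C : Fin t → Fin t' → Set} {P : Elt t s} {P' : Elt t' s} →
                Respects C P P' → Respects (flip C) P' P
Respects-flip P~P' rel = sym (P~P' (flip~ rel))

⨾ᴮ-forth : {C : Fin t → Fin t' → Set} → Forth C →
           {P Q : Elt t s} {P' Q' : Elt t' s} → Respects C P P' → Respects C Q Q' →
           {x : Atom t s} {y : Atom t' s} → AtomRel C x y → (P ⨾ᴮ Q) x ≡ true → (P' ⨾ᴮ Q') y ≡ true
⨾ᴮ-forth F {P} {Q} {P'} {Q'} P~P' Q~Q' {x} {y} rx h =
  let witness {a} {a'} P∋a Q∋a' allowed = ⨾ᴮ-elim {P = P} {Q} {x} h
      matched ra ra' coh = matchTriangle F a a' rx allowed
  in ⨾ᴮ-intro {P = P'} {Q'} {y} (witness (trans (sym (P~P' ra)) P∋a) (trans (sym (Q~Q' ra')) Q∋a')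
                                        (trans (sym (forbidden-resp ra ra' rx coh)) allowed))

⨾ᴮ-resp : {C : Fin t → Fin t' → Set} → BackAndForth C →
          {P Q : Elt t s} {P' Q' : Elt t' s} → Respects C P P' → Respects C Q Q' →
          Respects C (P ⨾ᴮ Q) (P' ⨾ᴮ Q')
⨾ᴮ-resp bf P~P' Q~Q' rx = ⇔→≡ (mk⇔
  (⨾ᴮ-forth (forth bf) P~P' Q~Q' rx)
  (⨾ᴮ-forth (back bf) (Respects-flip P~P') (Respects-flip Q~Q') (flip~ rx)))
  where open BackAndForth

module _ {C : Fin t → Fin t' → Set} (bf : BackAndForth C)
         {ās : Vec (Elt t s) m} {b̄s : Vec (Elt t' s) m}
         (vars : ∀ j → Respects C (lookup ās j) (lookup b̄s j)) where

  evalᴮ-resp : ∀ u → Respects C (evalᴮ ās u) (evalᴮ b̄s u)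
  evalᴮ-resp (var j) = vars j
  evalᴮ-resp 0t _ = refl
  evalᴮ-resp 1t _ = refl
  evalᴮ-resp 1't rx = ==-resp rx one~ (coherent-sym one~ rx tt)
  evalᴮ-resp (u +t v) rx = cong₂ _∨_ (evalᴮ-resp u rx) (evalᴮ-resp v rx)
  evalᴮ-resp (u ·t v) rx = cong₂ _∧_ (evalᴮ-resp u rx) (evalᴮ-resp v rx)
  evalᴮ-resp (u ⨾t v) = ⨾ᴮ-resp bf (evalᴮ-resp u) (evalᴮ-resp v)
  evalᴮ-resp (-t u) rx = cong not (evalᴮ-resp u rx)
  evalᴮ-resp (˘t u) rx = evalᴮ-resp u (conv~ rx)

  backAndForth⇒IsoCond : IsoCond ās b̄s
  backAndForth⇒IsoCond u v = mk⇔
    (λ u≈v y → let _ , ry , _ = coherentPartner (back bf) y one~ ; rx = flip~ ry in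
      trans (sym (evalᴮ-resp u rx)) (trans (u≈v _) (evalᴮ-resp v rx)))
    (λ u≈v x → let _ , rx , _ = coherentPartner (forth bf) x one~ in
      trans (evalᴮ-resp u rx) (trans (u≈v _) (sym (evalᴮ-resp v rx))))
    where open BackAndForth

∈⇒1≤∣p∣ : {p : Subset n} {x : Fin n} → x ∈ p → 1 ≤ ∣ p ∣
∈⇒1≤∣p∣ {x = x} x∈p = subst (_≤ _) (∣⁅x⁆∣≡1 x)
  (p⊆q⇒∣p∣≤∣q∣ λ y∈⁅x⁆ → subst (_∈ _) (sym (x∈⁅y⁆⇒x≡y x y∈⁅x⁆)) x∈p)

1≤∣p∣⇒nonempty : {p : Subset n} → 1 ≤ ∣ p ∣ → Nonempty p
1≤∣p∣⇒nonempty {n} {p} 1≤∣p∣ with nonempty? p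
... | yes ne = ne
... | no empty =
  contradiction (subst (1 ≤_) (trans (cong ∣_∣ (Empty-unique empty)) (∣⊥∣≡0 n)) 1≤∣p∣) λ ()

∈-≢-∈⇒2≤∣p∣ : {p : Subset n} {x y : Fin n} → x ∈ p → y ∈ p → x ≢ y → 2 ≤ ∣ p ∣
∈-≢-∈⇒2≤∣p∣ x∈p y∈p x≢y =
  ≤-trans (s≤s (∈⇒1≤∣p∣ (x∈p∧x≢y⇒x∈p-y y∈p (x≢y ∘ sym)))) (x∈p⇒∣p-x∣<∣p∣ x∈p)

2≤∣p∣⇒∃≢ : {p : Subset n} → 2 ≤ ∣ p ∣ → (x : Fin n) → ∃ λ y → y ∈ p × y ≢ x
2≤∣p∣⇒∃≢ {p = p} 2≤∣p∣ x with any? (λ y → y ∈? p ×-dec ¬? (y ≟ x))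
... | yes found = found
... | no none =
  contradiction (≤-trans 2≤∣p∣ (subst (_ ≤_) (∣⁅x⁆∣≡1 x) (p⊆q⇒∣p∣≤∣q∣ p⊆⁅x⁆))) λ { (s≤s ()) }
  where
  p⊆⁅x⁆ : p ⊆ ⁅ x ⁆
  p⊆⁅x⁆ {y} y∈p =
    subst (_∈ ⁅ x ⁆) (sym (decidable-stable (y ≟ x) λ y≢x → none (y , y∈p , y≢x))) (x∈⁅x⁆ x)

∈-tabulate : {f : Fin n → Bool} {z : Fin n} → z ∈ tabulate f ⇔ f z ≡ true
∈-tabulate {f = f} {z} = mk⇔
  (λ z∈ → trans (sym (lookup∘tabulate f z)) ([]=⇒lookup z∈))
  (λ fz → lookup⇒[]= z _ (trans (lookup∘tabulate f z) fz))

¬∀WinsAt-sym : {c c' : ℕ} → ¬ ∀WinsAt c c' → ¬ ∀WinsAt c' c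
¬∀WinsAt-sym safe (c'≢c , small) = safe (c'≢c ∘ sym , Sum.swap small)

¬∀WinsAt-≤ : {c c' k : ℕ} → ¬ ∀WinsAt c c' → k ≤ 2 → k ≤ c → k ≤ c'
¬∀WinsAt-≤ {c} {c'} {k} safe k≤2 k≤c = decidable-stable (k ≤? c') λ k≰c' →
  safe ((λ c≡c' → k≰c' (subst (k ≤_) c≡c' k≤c)) , inj₂ (<-≤-trans (≰⇒> k≰c') k≤2))

record Colouring (K : Set) (n : ℕ) : Set where
  field
    colour  : Fin n → K
    class   : K → Subset n
    ∈-class : ∀ {z κ} → z ∈ class κ ⇔ colour z ≡ κ

open Colouring

Balanced : {K : Set} → Colouring K t → Colouring K t' → Set
Balanced L R = ∀ κ → ¬ ∀WinsAt ∣ class L κ ∣ ∣ class R κ ∣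

SameColour : {K : Set} → Colouring K t → Colouring K t' → Fin t → Fin t' → Set
SameColour L R i i' = colour L i ≡ colour R i'

module _ {K : Set} {L : Colouring K t} {R : Colouring K t'} (balanced : Balanced L R) where

  balanced-forth : Forth (SameColour L R)
  balanced-forth = record { total = total ; extend = extend }
    where
    ∈-own-class : ∀ i → i ∈ class L (colour L i)
    ∈-own-class i = from (∈-class L) refl

    total : ∀ i → ∃ (SameColour L R i)
    total i =
      let i' , i'∈ = 1≤∣p∣⇒nonempty (¬∀WinsAt-≤ (balanced _) (s≤s z≤n) (∈⇒1≤∣p∣ (∈-own-class i)))
      in i' , sym (to (∈-class R) i'∈)

    extend : ∀ {k k'} → SameColour L R k k' →
             ∀ i → ∃ λ i' → SameColour L R i i' × (i =ᶠ k) ≡ (i' =ᶠ k')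
    extend {k} {k'} same i with i ≟ k
    ... | yes refl = k' , same , sym (=ᶠ-refl k')
    ... | no i≢k with i ∈? class L (colour L k)
    ...   | no i∉ =
      let i' , same' = total i in
      i' , same' , sym (≢⇒=ᶠ-false λ { refl → i∉ (from (∈-class L) (trans same' (sym same))) })
    ...   | yes i∈ =
      let 2≤∣R∣ = ¬∀WinsAt-≤ (balanced _) ≤-refl (∈-≢-∈⇒2≤∣p∣ i∈ (∈-own-class k) i≢k)
          i' , i'∈ , i'≢k' = 2≤∣p∣⇒∃≢ 2≤∣R∣ k'
      in i' , trans (to (∈-class L) i∈) (sym (to (∈-class R) i'∈)) , sym (≢⇒=ᶠ-false i'≢k')

balanced-backAndForth : {K : Set} {L : Colouring K t} {R : Colouring K t'} →
                        Balanced L R → BackAndForth (SameColour L R)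
balanced-backAndForth {L = L} {R} balanced = record
  { forth = balanced-forth {L = L} {R} balanced
  ; back  = Forth-resp (mk⇔ sym sym) (balanced-forth {L = R} {L} (¬∀WinsAt-sym ∘ balanced))
  }

paletteOf : Vec (Subset n) m → Fin n → Vec Bool m
paletteOf Ts z = map (λ T → lookup T z) Ts

inPal-paletteOf : (Ts : Vec (Subset n) m) (z : Fin n) → inPal Ts (paletteOf Ts z) z ≡ true
inPal-paletteOf [] z = refl
inPal-paletteOf (T ∷ Ts) z = cong₂ _∧_ (=ᵇ-refl (lookup T z)) (inPal-paletteOf Ts z)
  where
  =ᵇ-refl : ∀ u → (u =ᵇ u) ≡ true
  =ᵇ-refl true = refl
  =ᵇ-refl false = refl

inPal⇒paletteOf : (Ts : Vec (Subset n) m) (π : Vec Bool m) (z : Fin n) →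
                  inPal Ts π z ≡ true → paletteOf Ts z ≡ π
inPal⇒paletteOf [] [] z _ = refl
inPal⇒paletteOf (T ∷ Ts) (p ∷ π) z h =
  cong₂ _∷_ (=ᵇ-sound (∧-conicalˡ _ _ h)) (inPal⇒paletteOf Ts π z (∧-conicalʳ _ _ h))
  where
  =ᵇ-sound : ∀ {u v} → (u =ᵇ v) ≡ true → u ≡ v
  =ᵇ-sound {true} {true} _ = refl
  =ᵇ-sound {false} {false} _ = refl

palettes : Vec (Subset n) m → Colouring (Vec Bool m) n
palettes Ts = record
  { colour  = paletteOf Ts
  ; class   = λ π → tabulate (inPal Ts π)
  ; ∈-class = λ {z} {π} → mk⇔
      (inPal⇒paletteOf Ts π z ∘ to ∈-tabulate)
      (λ { refl → from ∈-tabulate (inPal-paletteOf Ts z) })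
  }

greenPart : Elt t s → Subset t
greenPart a = tabulate (λ i → a (g i))

graft : Elt t s → Subset t' → Elt t' s
graft a S one = a one
graft a S b = a b
graft a S w = a w
graft a S yy = a yy
graft a S (g i) = lookup S i
graft a S (r j k) = a (r j k)

SameNonGreen : Atom t s → Atom t' s → Set
SameNonGreen = AtomRel (λ _ _ → ⊥)

graft-nonGreen : (a : Elt t s) (S : Subset t') {x : Atom t s} {y : Atom t' s} →
                 SameNonGreen x y → a x ≡ graft a S y
graft-nonGreen a S one~ = refl
graft-nonGreen a S b~ = refl
graft-nonGreen a S w~ = refl
graft-nonGreen a S yy~ = refl
graft-nonGreen a S r~ = refl

record Matches (a : Elt t s) (c : Elt t' s) (S : Subset t) (S' : Subset t') : Set where
  field
    greenˡ   : ∀ i → a (g i) ≡ lookup S i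
    greenʳ   : ∀ i' → c (g i') ≡ lookup S' i'
    nonGreen : ∀ {x y} → SameNonGreen x y → a x ≡ c y

greenPart-lookup : (a : Elt t s) (i : Fin t) → a (g i) ≡ lookup (greenPart a) i
greenPart-lookup a i = sym (lookup∘tabulate (λ i → a (g i)) i)

graft-matchesʳ : (a : Elt t s) (S' : Subset t') → Matches a (graft a S') (greenPart a) S'
graft-matchesʳ a S' = record
  { greenˡ = greenPart-lookup a ; greenʳ = λ _ → refl ; nonGreen = graft-nonGreen a S' }

graft-matchesˡ : (c : Elt t' s) (S : Subset t) → Matches (graft c S) c S (greenPart c)
graft-matchesˡ c S = record
  { greenˡ = λ _ → refl ; greenʳ = greenPart-lookup c ; nonGreen = sym ∘ graft-nonGreen c S ∘ flip~ }

data Tracks {t t' s : ℕ} : Vec (Elt t s) m → Vec (Elt t' s) m → Vec (Subset t × Subset t') m → Set where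
  []  : Tracks [] [] []
  _∷_ : ∀ {a c S S'} {ās : Vec (Elt t s) m} {b̄s p} →
        Matches a c S S' → Tracks ās b̄s p → Tracks (a ∷ ās) (c ∷ b̄s) ((S , S') ∷ p)

module _ {t t' s : ℕ} where

  Tracks-∷ʳ : {ās : Vec (Elt t s) m} {b̄s : Vec (Elt t' s) m} {p : Vec (Subset t × Subset t') m}
              {a : Elt t s} {c : Elt t' s} {S : Subset t} {S' : Subset t'} →
              Tracks ās b̄s p → Matches a c S S' → Tracks (ās ∷ʳ a) (b̄s ∷ʳ c) (p ∷ʳ (S , S'))
  Tracks-∷ʳ [] M = M ∷ []
  Tracks-∷ʳ (M' ∷ tr) M = M' ∷ Tracks-∷ʳ tr M

  Tracks-lookup : {ās : Vec (Elt t s) m} {b̄s : Vec (Elt t' s) m} {p : Vec (Subset t × Subset t') m} →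
                  Tracks ās b̄s p → ∀ j →
                  Matches (lookup ās j) (lookup b̄s j) (proj₁ (lookup p j)) (proj₂ (lookup p j))
  Tracks-lookup (M ∷ _) zero = M
  Tracks-lookup (_ ∷ tr) (suc j) = Tracks-lookup tr j

  PaletteMatch : Vec (Subset t × Subset t') m → Fin t → Fin t' → Set
  PaletteMatch p = SameColour (palettes (map proj₁ p)) (palettes (map proj₂ p))

  paletteOf-lookup : {A : Set} (f : A → Subset n) (p : Vec A m) (j : Fin m) (z : Fin n) →
                     lookup (paletteOf (map f p) z) j ≡ lookup (f (lookup p j)) z
  paletteOf-lookup f p j z = trans (lookup-map j _ (map f p)) (cong (λ T → lookup T z) (lookup-map j f p))

  Tracks-respects : {ās : Vec (Elt t s) m} {b̄s : Vec (Elt t' s) m} {p : Vec (Subset t × Subset t') m} →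
                    Tracks ās b̄s p → ∀ j → Respects (PaletteMatch p) (lookup ās j) (lookup b̄s j)
  Tracks-respects {ās = ās} {b̄s} {p} tr j = respects
    where
    open Matches (Tracks-lookup tr j)
    respects : Respects (PaletteMatch p) (lookup ās j) (lookup b̄s j)
    respects one~ = nonGreen one~
    respects b~ = nonGreen b~
    respects w~ = nonGreen w~
    respects yy~ = nonGreen yy~
    respects r~ = nonGreen r~
    respects (g~ {i} {i'} samePalette) = begin
      lookup ās j (g i)                              ≡⟨ greenˡ i ⟩
      lookup (proj₁ (lookup p j)) i                  ≡⟨ paletteOf-lookup proj₁ p j i ⟨
      lookup (paletteOf (map proj₁ p) i) j           ≡⟨ cong (λ π → lookup π j) samePalette ⟩
      lookup (paletteOf (map proj₂ p) i') j          ≡⟨ paletteOf-lookup proj₂ p j i' ⟩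
      lookup (proj₂ (lookup p j)) i'                 ≡⟨ greenʳ i' ⟨
      lookup b̄s j (g i')                             ∎
      where open ≡-Reasoning

  tracking-strategy : ∀ k {ās : Vec (Elt t s) m} {b̄s : Vec (Elt t' s) m} {p : Vec (Subset t × Subset t') m} →
                      Tracks ās b̄s p → SWin k p → ΓWin k ās b̄s
  tracking-strategy zero {p = p} tr ok =
    -- SeuratOk p unfolds to Balanced (palettes (map proj₁ p)) (palettes (map proj₂ p)).
    backAndForth⇒IsoCond
      (balanced-backAndForth {L = palettes (map proj₁ p)} {palettes (map proj₂ p)} ok)
      (Tracks-respects tr)
  tracking-strategy (suc k) tr (_ , answerˡ , answerʳ) =
    (λ a → let S' , win = answerˡ (greenPart a) in
           graft a S' , tracking-strategy k (Tracks-∷ʳ tr (graft-matchesʳ a S')) win) ,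
    (λ c → let S , win = answerʳ (greenPart c) in
           graft c S , tracking-strategy k (Tracks-∷ʳ tr (graft-matchesˡ c S)) win)

proposition4p4 : (t t' s n : ℕ) → SeuratWin n t t' → EGameWin n t t' s
proposition4p4 t t' s n = tracking-strategy n []
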